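{- Let $n\ge3$ and let $\mathcal H_n$ be the directed $n\times n$ grid with monitor placement $\chi_{\mathtt g}$. Then $\mu(\mathcal H_n\mid\chi_{\mathtt g})\ge2$, under either the $\mathrm{CSP}$ or the $\mathrm{CAP}^-$ routing mechanism.
   Context: $\mathcal H_n$ is the directed graph with vertex set $[n]^2$ and an edge from $(x_1,x_2)$ to $(y_1,y_2)$ iff for some $i\in\{1,2\}$, $y_i-x_i=1$ and the other coordinate agrees. The monitor placement $\chi_{\mathtt g}=(\mathfrak m,\mathfrak M)$ has input nodes $\mathfrak m=\{(x_1,x_2): x_1=1\text{ or }x_2=1\}$ and output nodes $\mathfrak M=\{(x_1,x_2): x_1=n\text{ or }x_2=n\}$. The set of measurement paths $\mathbb P(G\mid\chi)$ (directed paths) depends on the routing mechanism: under $\mathrm{CSP}$ it consists of all simple directed paths from a node of $\mathfrak m$ to a different node of $\mathfrak M$; under $\mathrm{CAP}^-$ it consists of all directed walks starting in $\mathfrak m$ and ending in $\mathfrak M$, except single-node paths consisting of one node in $\mathfrak m\cap\mathfrak M$. For a node $v$, $\mathbb P(v)$ is the set of measurement paths through $v$, $\mathbb P(U)=\bigcup_{u\in U}\mathbb P(u)$. $V$ is $k$-identifiable if for all $U,W\subseteq V$ with $U\neq W$ and $|U|,|W|\le k$, $\mathbb P(U)\neq\mathbb P(W)$. $\mu(G\mid\chi)$ is the largest $k\ge0$ such that $V$ is $k$-identifiable. -}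

module Defs where

open import Data.Nat using (ℕ; zero; suc; _≤_)
open import Data.Fin using (Fin; toℕ)
open import Data.Product using (_×_; _,_; ∃)
open import Data.Sum using (_⊎_)
open import Data.List using (List; length)
open import Data.List.NonEmpty using (List⁺; toList; head; last)
open import Data.List.Membership.Propositional using (_∈_)
open import Data.List.Relation.Unary.Linked using (Linked)
open import Data.List.Relation.Unary.Unique.Propositional using (Unique)
open import Relation.Binary.PropositionalEquality using (_≡_)
open import Relation.Nullary using (¬_)

-- Vertices of the n×n grid: [n]^2, coordinates 0-indexed via Fin n
-- (coordinate value i ∈ Fin n stands for i+1 ∈ [n]).
Vertex : ℕ → Set
Vertex n = Fin n × Fin n

Edge : ∀ {n} → Vertex n → Vertex n → Set
Edge (x₁ , x₂) (y₁ , y₂) =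
  (toℕ y₁ ≡ suc (toℕ x₁) × x₂ ≡ y₂) ⊎ (x₁ ≡ y₁ × toℕ y₂ ≡ suc (toℕ x₂))

-- Monitor placement χ_g: inputs m (x₁ = 1 or x₂ = 1), outputs M (x₁ = n or x₂ = n).
Input : ∀ {n} → Vertex n → Set
Input (x₁ , x₂) = toℕ x₁ ≡ 0 ⊎ toℕ x₂ ≡ 0

Output : ∀ {n} → Vertex n → Set
Output {n} (x₁ , x₂) = suc (toℕ x₁) ≡ n ⊎ suc (toℕ x₂) ≡ n

IsWalk : ∀ {n} → List⁺ (Vertex n) → Set
IsWalk p = Linked Edge (toList p)

data Routing : Set where
  CSP CAP⁻ : Routing

MeasPath : ∀ {n} → Routing → List⁺ (Vertex n) → Set
MeasPath CSP p =
  IsWalk p × Unique (toList p) × Input (head p) × Output (last p) × ¬ (head p ≡ last p)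
MeasPath CAP⁻ p =
  IsWalk p × Input (head p) × Output (last p)
  × ¬ (length (toList p) ≡ 1 × Input (head p) × Output (head p))

PU : ∀ {n} → Routing → List (Vertex n) → List⁺ (Vertex n) → Set
PU r U p = MeasPath r p × ∃ λ u → u ∈ U × u ∈ toList p

SetOfSize≤ : ∀ {n} → ℕ → List (Vertex n) → Set
SetOfSize≤ k U = Unique U × length U ≤ k

SameSet : ∀ {n} → List (Vertex n) → List (Vertex n) → Set
SameSet U W = ∀ v → (v ∈ U → v ∈ W) × (v ∈ W → v ∈ U)

SamePaths : ∀ {n} → Routing → List (Vertex n) → List (Vertex n) → Set
SamePaths r U W = ∀ p → (PU r U p → PU r W p) × (PU r W p → PU r U p)

Identifiable : ℕ → ℕ → Routing → Set
Identifiable n k r = ∀ (U W : List (Vertex n)) →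
  SetOfSize≤ k U → SetOfSize≤ k W → ¬ SameSet U W → ¬ SamePaths r U W

module Submission where

-- The only measurement paths the proof needs are monotone lattice
-- paths: a sequence of points, each obtained from the previous one by raising
-- one coordinate by one, from an input point to an output point.  Such a path
-- is a measurement path under both routings, since every edge raises the
-- coordinate sum (so no vertex repeats and the ends differ).  Concretely we use
-- L-shaped paths (along a row, then up a column) and their transposes; full
-- rows and columns are special L-shapes.
--
-- Identifiability: let |U|,|W| ≤ 2 with P(U) = P(W); we show U ⊆ W, and W ⊆ U
-- by symmetry.  For u ∈ U the full row and full column through u are
-- measurement paths, so W has a vertex w₁ on u's row and w₂ on u's column.  If
-- neither is u, the column through w₁ and the row through w₂ force
-- U = {u, u'} with u, w₁, u', w₂ the corners of a proper rectangle, U one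
-- diagonal and W the other.  An L-shaped path through a corner of one
-- diagonal that avoids both corners of the other then lies in exactly one of
-- P(U), P(W) — a contradiction.

open import Defs
open import Data.Nat using (ℕ; zero; suc; _+_; _∸_; _⊓_; _≤_; _<_; z≤n; s≤s; _<?_; _≟_)
open import Data.Nat.Properties
open import Data.Fin using (Fin; toℕ; fromℕ<)
open import Data.Fin.Properties using (toℕ-fromℕ<; toℕ-injective; toℕ<n)
open import Data.Product using (∃-syntax; _×_; _,_; proj₁; proj₂; swap)
open import Data.Sum using (_⊎_; inj₁; inj₂) renaming (map to ⊎-map; swap to ⊎-swap)
open import Data.List using (List; []; _∷_; length; applyUpTo; initLast; _∷ʳ′_)
open import Data.List.NonEmpty using (List⁺; _∷_; toList; last)
open import Data.List.Membership.Propositional using (_∈_)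
open import Data.List.Membership.Propositional.Properties using (∈-applyUpTo⁺; ∈-applyUpTo⁻)
open import Data.List.Relation.Unary.Any using (here; there)
import Data.List.Relation.Unary.All as All
import Data.List.Relation.Unary.AllPairs as AllPairs
import Data.List.Relation.Unary.Linked as Linked
open import Data.List.Relation.Unary.Linked.Properties using (Linked⇒AllPairs; applyUpTo⁺₁)
open import Data.List.Relation.Unary.Unique.Propositional using (Unique)
open import Data.Empty using (⊥; ⊥-elim)
open import Function using (_∘_; _⇔_; mk⇔; Equivalence)
open import Relation.Binary.Definitions using (tri<; tri≈; tri>)
open import Relation.Binary.PropositionalEquality
open import Relation.Nullary using (¬_; yes; no)

open Equivalence using (to; from)

last-∷ : ∀ {A : Set} (x y : A) ys → last (x ∷ y ∷ ys) ≡ last (y ∷ ys)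
last-∷ x y ys with initLast ys
... | [] = refl
... | _ ∷ʳ′ _ = refl

increasing⇒unique : ∀ {A : Set} {R : A → A → Set} (f : A → ℕ) →
                    (∀ {x y} → R x y → f x < f y) →
                    ∀ {xs} → Linked.Linked R xs → Unique xs
increasing⇒unique f increasing chain =
  AllPairs.map (λ f[x]<f[y] x≡y → <⇒≢ f[x]<f[y] (cong f x≡y))
    (Linked⇒AllPairs <-trans (Linked.map increasing chain))

at-most-two : ∀ {A : Set} {xs : List A} {a b c : A} →
              length xs ≤ 2 → a ∈ xs → b ∈ xs → a ≢ b → c ∈ xs → c ≡ a ⊎ c ≡ b
at-most-two {xs = _ ∷ []} _ (here refl) (here refl) a≢b _ = ⊥-elim (a≢b refl)
at-most-two {xs = _ ∷ _ ∷ []} _ (here refl) (here refl) a≢b _ = ⊥-elim (a≢b refl)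
at-most-two {xs = _ ∷ _ ∷ []} _ (there (here refl)) (there (here refl)) a≢b _ = ⊥-elim (a≢b refl)
at-most-two {xs = _ ∷ _ ∷ []} _ (here refl) (there (here refl)) _ (here refl) = inj₁ refl
at-most-two {xs = _ ∷ _ ∷ []} _ (here refl) (there (here refl)) _ (there (here refl)) = inj₂ refl
at-most-two {xs = _ ∷ _ ∷ []} _ (there (here refl)) (here refl) _ (here refl) = inj₂ refl
at-most-two {xs = _ ∷ _ ∷ []} _ (there (here refl)) (here refl) _ (there (here refl)) = inj₁ refl
at-most-two {xs = _ ∷ _ ∷ _ ∷ _} (s≤s (s≤s ())) _ _ _ _

module Grid (m : ℕ) where

  V : Set
  V = Vertex (suc m)

  Point : Set
  Point = ℕ × ℕ

  InGrid : Point → Set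
  InGrid (x , y) = x ≤ m × y ≤ m

  ⟦_⟧ : V → Point
  ⟦ x , y ⟧ = toℕ x , toℕ y

  col row : V → ℕ
  col v = proj₁ ⟦ v ⟧
  row v = proj₂ ⟦ v ⟧

  ⟦⟧-injective : ∀ {u v} → ⟦ u ⟧ ≡ ⟦ v ⟧ → u ≡ v
  ⟦⟧-injective eq =
    cong₂ _,_ (toℕ-injective (cong proj₁ eq)) (toℕ-injective (cong proj₂ eq))

  same-vertex : ∀ {u v} → col u ≡ col v → row u ≡ row v → u ≡ v
  same-vertex col≡ row≡ = ⟦⟧-injective (cong₂ _,_ col≡ row≡)

  ⟦⟧-inGrid : ∀ v → InGrid ⟦ v ⟧
  ⟦⟧-inGrid (x , y) = ≤-pred (toℕ<n x) , ≤-pred (toℕ<n y)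

  inGrid-at : ∀ {v P} → ⟦ v ⟧ ≡ P → InGrid P
  inGrid-at {v} refl = ⟦⟧-inGrid v

  -- The vertex at a point (an arbitrary one outside the grid).
  clamp : ℕ → Fin (suc m)
  clamp k with k <? suc m
  ... | yes k<n = fromℕ< k<n
  ... | no _ = Fin.zero

  vertex : Point → V
  vertex (x , y) = clamp x , clamp y

  toℕ-clamp : ∀ {k} → k ≤ m → toℕ (clamp k) ≡ k
  toℕ-clamp {k} k≤m with k <? suc m
  ... | yes k<n = toℕ-fromℕ< k<n
  ... | no k≮n = ⊥-elim (k≮n (s≤s k≤m))

  ⟦vertex⟧ : ∀ {P} → InGrid P → ⟦ vertex P ⟧ ≡ P
  ⟦vertex⟧ (x≤m , y≤m) = cong₂ _,_ (toℕ-clamp x≤m) (toℕ-clamp y≤m)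

  InputPt OutputPt : Point → Set
  InputPt (x , y) = x ≡ 0 ⊎ y ≡ 0
  OutputPt (x , y) = x ≡ m ⊎ y ≡ m

  Step : Point → Point → Set
  Step (x , y) (x' , y') = (x' ≡ suc x × y ≡ y') ⊎ (x ≡ x' × y' ≡ suc y)

  Step-swap : ∀ {P Q} → Step P Q → Step (swap P) (swap Q)
  Step-swap (inj₁ (x'≡1+x , y≡y')) = inj₂ (y≡y' , x'≡1+x)
  Step-swap (inj₂ (x≡x' , y'≡1+y)) = inj₁ (y'≡1+y , x≡x')

  step⇒edge : ∀ {P Q} → InGrid P → InGrid Q → Step P Q → Edge (vertex P) (vertex Q)
  step⇒edge P∈ Q∈ step
    with subst₂ Step (sym (⟦vertex⟧ P∈)) (sym (⟦vertex⟧ Q∈)) step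
  ... | inj₁ (x'≡1+x , y≡y') = inj₁ (x'≡1+x , toℕ-injective y≡y')
  ... | inj₂ (x≡x' , y'≡1+y) = inj₂ (toℕ-injective x≡x' , y'≡1+y)

  weight : V → ℕ
  weight v = col v + row v

  edge-increases-weight : ∀ {u v} → Edge u v → weight u < weight v
  edge-increases-weight (inj₁ (x'≡1+x , refl)) rewrite x'≡1+x = ≤-refl
  edge-increases-weight (inj₂ (refl , y'≡1+y)) rewrite y'≡1+y = ≤-reflexive (sym (+-suc _ _))

  trace : (ℕ → Point) → ℕ → List⁺ V
  trace h k = vertex (h 0) ∷ applyUpTo (vertex ∘ h ∘ suc) k

  Visits : (ℕ → Point) → ℕ → Point → Set
  Visits h k P = ∃[ i ] i ≤ k × h i ≡ P

  Visits-swap : ∀ {h k P} → Visits h k P → Visits (swap ∘ h) k (swap P)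
  Visits-swap (i , i≤k , h[i]≡P) = i , i≤k , cong swap h[i]≡P

  trace-last : ∀ h k → last (trace h k) ≡ vertex (h k)
  trace-last h zero = refl
  trace-last h (suc k) =
    trans (last-∷ (vertex (h 0)) (vertex (h 1)) (applyUpTo (vertex ∘ h ∘ suc ∘ suc) k))
          (trace-last (h ∘ suc) k)

  trace-nontrivial : ∀ h k → 1 ≤ k → length (toList (trace h k)) ≢ 1
  trace-nontrivial h (suc k) _ ()

  trace-ends-differ : ∀ h k → 1 ≤ k → Unique (toList (trace h k)) →
                      vertex (h 0) ≢ vertex (h k)
  trace-ends-differ h (suc k) _ (head∉tail AllPairs.∷ _) =
    All.lookup head∉tail (∈-applyUpTo⁺ (vertex ∘ h ∘ suc) ≤-refl)

  ∈-trace : ∀ h k {v} → (∀ i → InGrid (h i)) →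
            v ∈ toList (trace h k) ⇔ Visits h k ⟦ v ⟧
  ∈-trace h k h∈ = mk⇔ index member
    where
    index : ∀ {v} → v ∈ toList (trace h k) → Visits h k ⟦ v ⟧
    index v∈ with ∈-applyUpTo⁻ (vertex ∘ h) v∈
    ... | i , i<1+k , refl = i , ≤-pred i<1+k , sym (⟦vertex⟧ (h∈ i))
    member : ∀ {v} → Visits h k ⟦ v ⟧ → v ∈ toList (trace h k)
    member (i , i≤k , h[i]≡v) =
      subst (_∈ _) (⟦⟧-injective (trans (⟦vertex⟧ (h∈ i)) h[i]≡v))
        (∈-applyUpTo⁺ (vertex ∘ h) (s≤s i≤k))

  record LatticePath (S : Point → Set) : Set where
    field
      len        : ℕ
      point      : ℕ → Point
      inGrid     : ∀ i → InGrid (point i)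
      steps      : ∀ i → i < len → Step (point i) (point (suc i))
      nontrivial : 1 ≤ len
      start      : InputPt (point 0)
      end        : OutputPt (point len)
      shape      : ∀ P → S P ⇔ Visits point len P

  transpose : ∀ {S} → LatticePath S → LatticePath (S ∘ swap)
  transpose L = record
    { len = len
    ; point = swap ∘ point
    ; inGrid = swap ∘ inGrid
    ; steps = λ i i<len → Step-swap (steps i i<len)
    ; nontrivial = nontrivial
    ; start = ⊎-swap start
    ; end = ⊎-swap end
    ; shape = λ P → mk⇔ (Visits-swap ∘ to (shape (swap P)))
                        (from (shape (swap P)) ∘ Visits-swap)
    }
    where open LatticePath L

  module _ (r : Routing) where

    record Traced (S : Point → Set) : Set where
      field
        path     : List⁺ V
        measured : MeasPath r path
        vertices : ∀ v → v ∈ toList path ⇔ S ⟦ v ⟧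

    traced : ∀ {S} → LatticePath S → Traced S
    traced L = record
      { path = trace point len
      ; measured = measurement-path r
      ; vertices = λ v → mk⇔ (from (shape ⟦ v ⟧) ∘ to (∈-trace point len inGrid))
                             (from (∈-trace point len inGrid) ∘ to (shape ⟦ v ⟧))
      }
      where
      open LatticePath L
      walk : IsWalk (trace point len)
      walk = applyUpTo⁺₁ (vertex ∘ point) (suc len)
        (λ {i} i<len → step⇒edge (inGrid i) (inGrid (suc i)) (steps i (≤-pred i<len)))
      simple : Unique (toList (trace point len))
      simple = increasing⇒unique weight edge-increases-weight walk
      input : Input (vertex (point 0))
      input = subst InputPt (sym (⟦vertex⟧ (inGrid 0))) start
      output : Output (last (trace point len))
      output = subst Output (sym (trace-last point len))
        (⊎-map (cong suc) (cong suc) (subst OutputPt (sym (⟦vertex⟧ (inGrid len))) end))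
      measurement-path : ∀ r → MeasPath r (trace point len)
      measurement-path CSP = walk , simple , input , output ,
        λ eq → trace-ends-differ point len nontrivial simple (trans eq (trace-last point len))
      measurement-path CAP⁻ = walk , input , output ,
        λ (single , _) → trace-nontrivial point len nontrivial single

  LShape : ℕ → ℕ → ℕ → Point → Set
  LShape j a t (x , y) = (y ≡ j × x ≤ a) ⊎ (x ≡ a × j ≤ y × y ≤ t)

  -- The lattice path through an L-shape: its i-th point lies i steps along it.
  module L-shaped (j a t : ℕ) (j≤t : j ≤ t) where
    len : ℕ
    len = a + (t ∸ j)

    ℓ : ℕ → Point
    ℓ i = i ⊓ a , j + (i ∸ a) ⊓ (t ∸ j)

    ℓ-row : ∀ {x} → x ≤ a → ℓ x ≡ (x , j)
    ℓ-row {x} x≤a = cong₂ _,_ (m≤n⇒m⊓n≡m x≤a)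
      (trans (cong (λ d → j + d ⊓ (t ∸ j)) (m≤n⇒m∸n≡0 x≤a)) (+-identityʳ j))

    ℓ-col : ∀ {y} → j ≤ y → y ≤ t → ℓ (a + (y ∸ j)) ≡ (a , y)
    ℓ-col {y} j≤y y≤t = cong₂ _,_ (m≥n⇒m⊓n≡n (m≤m+n a (y ∸ j))) (begin
      j + (a + (y ∸ j) ∸ a) ⊓ (t ∸ j) ≡⟨ cong (λ d → j + d ⊓ (t ∸ j)) (m+n∸m≡n a (y ∸ j)) ⟩
      j + (y ∸ j) ⊓ (t ∸ j)           ≡⟨ cong (j +_) (m≤n⇒m⊓n≡m (∸-monoˡ-≤ j y≤t)) ⟩
      j + (y ∸ j)                     ≡⟨ m+[n∸m]≡n j≤y ⟩
      y                               ∎)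
      where open ≡-Reasoning

    ℓ-height : ∀ i → proj₂ (ℓ i) ≤ t
    ℓ-height i = ≤-trans (+-monoʳ-≤ j (m⊓n≤n (i ∸ a) (t ∸ j))) (≤-reflexive (m+[n∸m]≡n j≤t))

    ℓ-step : ∀ i → i < len → Step (ℓ i) (ℓ (suc i))
    ℓ-step i i<len with i <? a
    ... | yes i<a = inj₁ (along , level)
      where
      along : suc i ⊓ a ≡ suc (i ⊓ a)
      along = trans (m≤n⇒m⊓n≡m i<a) (cong suc (sym (m≤n⇒m⊓n≡m (<⇒≤ i<a))))
      level : j + (i ∸ a) ⊓ (t ∸ j) ≡ j + (suc i ∸ a) ⊓ (t ∸ j)
      level = cong (λ d → j + d ⊓ (t ∸ j))
                   (trans (m≤n⇒m∸n≡0 (<⇒≤ i<a)) (sym (m≤n⇒m∸n≡0 i<a)))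
    ... | no i≮a = inj₂ (column , rise)
      where
      open ≡-Reasoning
      a≤i : a ≤ i
      a≤i = ≮⇒≥ i≮a
      climbed<height : i ∸ a < t ∸ j
      climbed<height = subst (i ∸ a <_) (m+n∸m≡n a (t ∸ j)) (∸-monoˡ-< i<len a≤i)
      column : i ⊓ a ≡ suc i ⊓ a
      column = trans (m≥n⇒m⊓n≡n a≤i) (sym (m≥n⇒m⊓n≡n (m≤n⇒m≤1+n a≤i)))
      rise : j + (suc i ∸ a) ⊓ (t ∸ j) ≡ suc (j + (i ∸ a) ⊓ (t ∸ j))
      rise = begin
        j + (suc i ∸ a) ⊓ (t ∸ j)   ≡⟨ cong (λ d → j + d ⊓ (t ∸ j)) (+-∸-assoc 1 a≤i) ⟩
        j + suc (i ∸ a) ⊓ (t ∸ j)   ≡⟨ cong (j +_) (m≤n⇒m⊓n≡m climbed<height) ⟩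
        j + suc (i ∸ a)             ≡⟨ +-suc j (i ∸ a) ⟩
        suc (j + (i ∸ a))           ≡⟨ cong (λ d → suc (j + d)) (sym (m≤n⇒m⊓n≡m (<⇒≤ climbed<height))) ⟩
        suc (j + (i ∸ a) ⊓ (t ∸ j)) ∎

    ℓ-shape : ∀ i → LShape j a t (ℓ i)
    ℓ-shape i with i <? a
    ... | yes i<a = inj₁ (cong proj₂ (ℓ-row (<⇒≤ i<a)) , m⊓n≤n i a)
    ... | no i≮a = inj₂ (m≥n⇒m⊓n≡n (≮⇒≥ i≮a) , m≤m+n j _ , ℓ-height i)

    shape-visited : ∀ {P} → LShape j a t P → Visits ℓ len P
    shape-visited {x , _} (inj₁ (refl , x≤a)) = x , ≤-trans x≤a (m≤m+n a _) , ℓ-row x≤a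
    shape-visited {_ , y} (inj₂ (refl , j≤y , y≤t)) =
      a + (y ∸ j) , +-monoʳ-≤ a (∸-monoˡ-≤ j y≤t) , ℓ-col j≤y y≤t

  L-path : ∀ {j a t} → j ≤ t → a ≤ m → t ≤ m → a ≡ m ⊎ t ≡ m →
           1 ≤ a + (t ∸ j) → LatticePath (LShape j a t)
  L-path {j} {a} {t} j≤t a≤m t≤m on-boundary 1≤len = record
    { len = len
    ; point = ℓ
    ; inGrid = λ i → ≤-trans (m⊓n≤n i a) a≤m , ≤-trans (ℓ-height i) t≤m
    ; steps = ℓ-step
    ; nontrivial = 1≤len
    ; start = inj₁ refl
    ; end = subst OutputPt (sym (ℓ-col j≤t ≤-refl)) on-boundary
    ; shape = λ P → mk⇔ shape-visited λ { (i , _ , refl) → ℓ-shape i }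
    }
    where open L-shaped j a t j≤t

  -- A full row, as the L-shape that never turns up.
  row-path : 1 ≤ m → ∀ {y} → y ≤ m → LatticePath (LShape y m y)
  row-path 1≤m {y} y≤m =
    L-path ≤-refl ≤-refl y≤m (inj₁ refl) (≤-trans 1≤m (m≤m+n m (y ∸ y)))

  on-row : ∀ {y x y'} → LShape y m y (x , y') → y' ≡ y
  on-row (inj₁ (y'≡y , _)) = y'≡y
  on-row (inj₂ (_ , y≤y' , y'≤y)) = ≤-antisym y'≤y y≤y'

  record Separator (a b c d : ℕ) : Set₁ where
    field
      Shape    : Point → Set
      lattice  : LatticePath Shape
      meets    : Shape (a , d) ⊎ Shape (c , b)
      avoids₁  : ¬ Shape (a , b)
      avoids₂  : ¬ Shape (c , d)

  -- If a > 0 go along row b+1 to column a and up to the top; if a = 0 go up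
  -- column 1 to row b and along to the right edge.  Either path has ≥ 2 points
  -- because m ≥ 2.
  separator : ∀ {a b c d} → 2 ≤ m → a < c → c ≤ m → b < d → d ≤ m → Separator a b c d
  separator {zero} {b} {c} {d} 2≤m 0<c c≤m b<d d≤m = record
    { Shape = LShape 1 b m ∘ swap
    ; lattice = transpose (L-path (≤-trans (n≤1+n 1) 2≤m) (≤-trans (<⇒≤ b<d) d≤m) ≤-refl
                                  (inj₂ refl) (≤-trans (∸-monoˡ-≤ 1 2≤m) (m≤n+m (m ∸ 1) b)))
    ; meets = inj₂ (inj₂ (refl , 0<c , c≤m))
    ; avoids₁ = λ { (inj₁ (() , _)) ; (inj₂ (_ , () , _)) }
    ; avoids₂ = λ { (inj₁ (_ , d≤b)) → <⇒≱ b<d d≤b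
                  ; (inj₂ (d≡b , _)) → <⇒≢ b<d (sym d≡b) }
    }
  separator {suc a} {b} {c} {d} 2≤m a<c c≤m b<d d≤m = record
    { Shape = LShape (suc b) (suc a) m
    ; lattice = L-path (≤-trans b<d d≤m) (≤-trans (<⇒≤ a<c) c≤m) ≤-refl (inj₂ refl) (s≤s z≤n)
    ; meets = inj₁ (inj₂ (refl , b<d , d≤m))
    ; avoids₁ = λ { (inj₁ (b≡1+b , _)) → <⇒≢ (n<1+n b) b≡1+b
                  ; (inj₂ (_ , 1+b≤b , _)) → 1+n≰n 1+b≤b }
    ; avoids₂ = λ { (inj₁ (_ , c≤a)) → <⇒≱ a<c c≤a
                  ; (inj₂ (c≡a , _)) → <⇒≢ a<c (sym c≡a) }
    }

  SamePaths-sym : ∀ {r} {U W : List V} → SamePaths r U W → SamePaths r W U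
  SamePaths-sym same p = swap (same p)

  Within : List V → V → V → Set
  Within B γ δ = ∀ v → v ∈ B → v ≡ γ ⊎ v ≡ δ

  Meets : List V → (Point → Set) → Set
  Meets A S = ∃[ v ] v ∈ A × S ⟦ v ⟧

  module Identification (r : Routing) (2≤m : 2 ≤ m) where

    1≤m : 1 ≤ m
    1≤m = ≤-trans (n≤1+n 1) 2≤m

    mate : ∀ {U W S} → SamePaths r U W → Traced r S →
           Meets U S → Meets W S
    mate same T (u , u∈U , S[u]) =
      let _ , w , w∈W , w∈path = proj₁ (same path) (measured , u , u∈U , from (vertices u) S[u])
      in w , w∈W , to (vertices w) w∈path
      where open Traced T

    row-mate : ∀ {U W u} → SamePaths r U W → u ∈ U → ∃[ w ] w ∈ W × row w ≡ row u
    row-mate {u = u} same u∈U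
      with mate same (traced r (row-path 1≤m (proj₂ (⟦⟧-inGrid u))))
                (u , u∈U , inj₁ (refl , proj₁ (⟦⟧-inGrid u)))
    ... | w , w∈W , on-u's-row = w , w∈W , on-row on-u's-row

    col-mate : ∀ {U W u} → SamePaths r U W → u ∈ U → ∃[ w ] w ∈ W × col w ≡ col u
    col-mate {u = u} same u∈U
      with mate same (traced r (transpose (row-path 1≤m (proj₁ (⟦⟧-inGrid u)))))
                (u , u∈U , inj₁ (refl , proj₂ (⟦⟧-inGrid u)))
    ... | w , w∈W , on-u's-col = w , w∈W , on-row on-u's-col

    corners-separated : ∀ {A B a b c d α β γ δ} → SamePaths r A B → a < c → b < d →
      α ∈ A → ⟦ α ⟧ ≡ (a , d) → β ∈ A → ⟦ β ⟧ ≡ (c , b) →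
      Within B γ δ → ⟦ γ ⟧ ≡ (a , b) → ⟦ δ ⟧ ≡ (c , d) → ⊥
    corners-separated {A} {B} {α = α} {β = β} same a<c b<d α∈A α-at β∈A β-at B⊆ γ-at δ-at =
      unmet (mate same (traced r lattice) met)
      where
      open Separator (separator 2≤m a<c (proj₁ (inGrid-at β-at)) b<d (proj₂ (inGrid-at α-at)))
      met : Meets A Shape
      met with meets
      ... | inj₁ S[a,d] = α , α∈A , subst Shape (sym α-at) S[a,d]
      ... | inj₂ S[c,b] = β , β∈A , subst Shape (sym β-at) S[c,b]
      unmet : ¬ Meets B Shape
      unmet (w , w∈B , S[w]) with B⊆ w w∈B
      ... | inj₁ refl = avoids₁ (subst Shape γ-at S[w])
      ... | inj₂ refl = avoids₂ (subst Shape δ-at S[w])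

    rectangle : ∀ {U W u u' w₁ w₂ x y x' y'} → SamePaths r U W →
      Within U u u' → Within W w₁ w₂ → u ∈ U → u' ∈ U → w₁ ∈ W → w₂ ∈ W →
      ⟦ u ⟧ ≡ (x , y) → ⟦ u' ⟧ ≡ (x' , y') → ⟦ w₁ ⟧ ≡ (x' , y) → ⟦ w₂ ⟧ ≡ (x , y') →
      x ≢ x' → y ≢ y' → ⊥
    rectangle {x = x} {y} {x'} {y'}
              same U⊆ W⊆ u∈U u'∈U w₁∈W w₂∈W u-at u'-at w₁-at w₂-at x≢x' y≢y'
      with <-cmp x x' | <-cmp y y'
    ... | tri≈ _ x≡x' _ | _ = x≢x' x≡x'
    ... | _ | tri≈ _ y≡y' _ = y≢y' y≡y'
    ... | tri< x<x' _ _ | tri< y<y' _ _ =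
      corners-separated (SamePaths-sym same) x<x' y<y' w₂∈W w₂-at w₁∈W w₁-at U⊆ u-at u'-at
    ... | tri< x<x' _ _ | tri> _ _ y'<y =
      corners-separated same x<x' y'<y u∈U u-at u'∈U u'-at (λ v → ⊎-swap ∘ W⊆ v) w₂-at w₁-at
    ... | tri> _ _ x'<x | tri< y<y' _ _ =
      corners-separated same x'<x y<y' u'∈U u'-at u∈U u-at W⊆ w₁-at w₂-at
    ... | tri> _ _ x'<x | tri> _ _ y'<y =
      corners-separated (SamePaths-sym same) x'<x y'<y w₁∈W w₁-at w₂∈W w₂-at
                        (λ v → ⊎-swap ∘ U⊆ v) u'-at u-at

    ⊆-of-same : ∀ {U W} → SamePaths r U W → length U ≤ 2 → length W ≤ 2 →
                ∀ {u} → u ∈ U → u ∈ W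
    ⊆-of-same {U} {W} same |U|≤2 |W|≤2 {u} u∈U
      with row-mate same u∈U | col-mate same u∈U
    ... | w₁ , w₁∈W , w₁-row | w₂ , w₂∈W , w₂-col
      with col w₁ ≟ col u | row w₂ ≟ row u
    ... | yes w₁-col | _ = subst (_∈ W) (same-vertex w₁-col w₁-row) w₁∈W
    ... | no _ | yes w₂-row = subst (_∈ W) (same-vertex w₂-col w₂-row) w₂∈W
    ... | no w₁-col | no w₂-row
      with col-mate (SamePaths-sym same) w₁∈W | row-mate (SamePaths-sym same) w₂∈W
    ... | u' , u'∈U , u'-col | u'' , u''∈U , u''-row =
      ⊥-elim (rectangle same U⊆ W⊆ u∈U u'∈U w₁∈W w₂∈W refl u'-at
                        (cong (col w₁ ,_) w₁-row) (cong (_, row w₂) w₂-col)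
                        (w₁-col ∘ sym) (w₂-row ∘ sym))
      where
      -- u and the U-vertex u' in w₁'s column differ, so U = {u, u'}; the
      -- U-vertex in w₂'s row is not u, hence it is u' and u' = (col w₁, row w₂).
      U⊆ : Within U u u'
      U⊆ v = at-most-two |U|≤2 u∈U u'∈U
               (λ u≡u' → w₁-col (trans (sym u'-col) (cong col (sym u≡u'))))
      W⊆ : Within W w₁ w₂
      W⊆ v = at-most-two |W|≤2 w₁∈W w₂∈W
               (λ w₁≡w₂ → w₁-col (trans (cong col w₁≡w₂) w₂-col))
      u''≡u' : u'' ≡ u'
      u''≡u' with U⊆ u'' u''∈U
      ... | inj₁ u''≡u = ⊥-elim (w₂-row (trans (sym u''-row) (cong row u''≡u)))
      ... | inj₂ u''≡u' = u''≡u'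
      u'-at : ⟦ u' ⟧ ≡ (col w₁ , row w₂)
      u'-at = cong₂ _,_ u'-col (trans (cong row (sym u''≡u')) u''-row)

lemma6 : (n : ℕ) → 3 ≤ n → (r : Routing) → Identifiable n 2 r
lemma6 (suc m) (s≤s 2≤m) r U W (_ , |U|≤2) (_ , |W|≤2) U≢W same =
  U≢W (λ v → ⊆-of-same same |U|≤2 |W|≤2 , ⊆-of-same (SamePaths-sym same) |W|≤2 |U|≤2)
  where
  open Grid m
  open Identification r 2≤m
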